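{- For every forest \(G\) on \(n\) vertices, every \(m\in\{1,\dots,n\}\), and every real \(0<c<1\), there is a partition \((B,W)\) of \(V(G)\) that satisfies \(e_G(B,W)\leq \lceil 2c/(1-c)\rceil\,\Delta(G)\) and \(cm < |B| \leq m\).
   Context: \(e_G(B,W)\) is the number of edges with one end in \(B\) and the other in \(W\); \(\Delta(G)\) is the maximum degree of \(G\).
   Formalization: The parameter c ranges over the rationals with 0<c<1 rather than over all reals. -}

module Defs where

open import Data.Bool using (Bool; true; false; _∧_; not)
open import Data.Nat using (ℕ; _⊔_; _≤_)
open import Data.Fin using (Fin)
open import Data.List using (List; []; _∷_; _++_; length; map; foldr; allFin)
open import Data.Nat.ListAction using (sum)
open import Data.List.Relation.Unary.Linked using (Linked)
open import Data.List.Relation.Unary.Unique.Propositional using (Unique)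
open import Data.Product using (Σ; _×_)
open import Relation.Binary.PropositionalEquality using (_≡_; subst)
open import Relation.Nullary using (¬_)
open import Data.Integer using (ℤ; +_)
open import Data.Rational as ℚ using (ℚ; 0ℚ; 1ℚ; _<_; _÷_; ceiling; >-nonZero)
open import Data.Rational.Properties using (+-mono-<-≤; ≤-refl; +-inverseʳ)

record Graph (n : ℕ) : Set where
  field
    adj    : Fin n → Fin n → Bool
    sym    : ∀ u v → adj u v ≡ adj v u
    irrefl : ∀ v → adj v v ≡ false
open Graph public

Adj : ∀ {n} → Graph n → Fin n → Fin n → Set
Adj G u v = adj G u v ≡ true

record Cycle {n : ℕ} (G : Graph n) : Set where
  field
    start  : Fin n
    rest   : List (Fin n)
    long   : 2 ≤ length rest
    unique : Unique (start ∷ rest)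
    closed : Linked (Adj G) (start ∷ rest ++ start ∷ [])

Forest : ∀ {n} → Graph n → Set
Forest G = ¬ Cycle G

count : ∀ {n} → (Fin n → Bool) → ℕ
count {n} P = sum (map (λ v → if′ (P v)) (allFin n))
  where
  if′ : Bool → ℕ
  if′ true  = 1
  if′ false = 0

∣_∣ˢ : ∀ {n} → (Fin n → Bool) → ℕ
∣ B ∣ˢ = count B

-- e_G(B, W) with W the complement of B: each edge between B and W is
-- counted once, from its endpoint in B.
eBW : ∀ {n} → Graph n → (Fin n → Bool) → ℕ
eBW {n} G B = sum (map (λ u → count (λ v → B u ∧ not (B v) ∧ adj G u v)) (allFin n))

degree : ∀ {n} → Graph n → Fin n → ℕ
degree G u = count (adj G u)

-- maximum degree Δ(G) (0 for the empty graph)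
Δ : ∀ {n} → Graph n → ℕ
Δ {n} G = foldr _⊔_ 0 (map (degree G) (allFin n))

toℚ : ℕ → ℚ
toℚ k = (+ k) ℚ./ 1

0<1-c : ∀ {c} → c < 1ℚ → 0ℚ < 1ℚ ℚ.- c
0<1-c {c} c<1 = subst (_< 1ℚ ℚ.- c) (+-inverseʳ c) (+-mono-<-≤ c<1 (≤-refl {ℚ.- c}))

ceilRatio : (c : ℚ) → c < 1ℚ → ℤ
ceilRatio c c<1 = ceiling ((toℚ 2 ℚ.* c) ÷ (1ℚ ℚ.- c))
  where instance _ = >-nonZero (0<1-c c<1)

{-# OPTIONS --safe #-}
module Submission where

open import Defs renaming (sym to adj-sym)
open import Algebra.Properties.CommutativeSemigroup using (interchange)
open import Data.Bool as Bool using (Bool; true; false; _∧_; _∨_; not; T)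
open import Data.Bool.Properties using (T-∧; T-∨; T-≡)
open import Data.Empty using (⊥-elim)
open import Data.Fin using (Fin; zero; suc)
import Data.Fin.Properties as Fin
open import Data.Integer as ℤ using (ℤ; +_; +[1+_]; +0)
import Data.Integer.Properties as ℤ
open import Data.Integer.DivMod using ([n/d]*d≤n)
open import Data.List using (List; []; _∷_; _++_; map; allFin; length; foldr)
open import Data.List.Membership.Propositional using (_∈_)
open import Data.List.Membership.Propositional.Properties using (∈-allFin; ∈-map⁺; ∈-∃++)
open import Data.List.Properties using (map-cong; map-tabulate; length-tabulate; length-++)
import Data.List.Relation.Unary.All as All
open import Data.List.Relation.Unary.All using (All; []; _∷_)
import Data.List.Relation.Unary.All.Properties as All
open import Data.List.Relation.Unary.All.Properties using (¬Any⇒All¬)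
import Data.List.Relation.Unary.AllPairs as AllPairs
open import Data.List.Relation.Unary.AllPairs using ([]; _∷_)
open import Data.List.Relation.Unary.Any using (here; there)
open import Data.List.Relation.Unary.Linked using (Linked; [-]; _∷_)
open import Data.List.Relation.Unary.Unique.Propositional using (Unique)
open import Data.Nat as ℕ using (ℕ; zero; suc; _+_; _*_; _∸_; _≤_; _<_; _⊔_; z≤n; s≤s; z<s)
open import Data.Nat.Induction using (<-wellFounded)
open import Data.Nat.ListAction using (sum)
open import Data.Nat.Properties
open import Data.Nat.Solver using (module +-*-Solver)
open import Data.Product using (Σ; ∃; _×_; _,_; proj₁; proj₂)
open import Data.Rational as ℚ using (ℚ; mkℚ; 0ℚ; 1ℚ; ↥_; ↧_)
import Data.Rational.Properties as ℚ
import Data.Rational.Solver as ℚ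
open import Data.Rational.Unnormalised as ℚᵘ using (mkℚᵘ; *≡*; *≤*; *<*)
import Data.Rational.Unnormalised.Properties as ℚᵘ
open import Data.Sum using (_⊎_; inj₁; inj₂)
open import Function using (_∘_; id; Equivalence)
open import Induction.WellFounded using (Acc; acc)
open import Relation.Binary.PropositionalEquality
open import Relation.Nullary using (¬_; ¬?; yes; no; contradiction; _×-dec_)
open import Relation.Nullary.Decidable
  using (decidable-stable; toSum; T?; isYes; isNo; toWitness; fromWitness; toWitnessFalse; fromWitnessFalse)

-- In a forest, a vertex set W with |W| ≥ g ≥ 1 contains a piece P with
-- g ≤ 2|P| and |P| ≤ g all of whose edges into W ∖ P leave from one vertex,
-- so there are at most Δ of them.  To find it, start with singleton bags,
-- one per vertex of W, and repeatedly merge the bag of a leaf of the forest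
-- spanned by the bag owners into the bag of its neighbour, until some bag
-- has at least g/2 vertices (a last remaining bag would contain all of W).
-- Edges between bags always join owners, and merging two bags with fewer
-- than g/2 vertices gives at most g.  Applying this k = ⌈2c/(1-c)⌉ times,
-- each time to the complement W of the current B and with g the gap m - |B|,
-- adds at most Δ cut edges per round while at least halving the gap, so in
-- the end the gap is at most m/(k+1) < (1-c)m.

private
  variable
    A : Set
    f g : A → ℕ

T-not⇒¬T : ∀ {b} → T (not b) → ¬ T b
T-not⇒¬T {false} _ ()

indicator : Bool → ℕ
indicator true  = 1
indicator false = 0

_⊆_ : ∀ {n} → (Fin n → Bool) → (Fin n → Bool) → Set
S ⊆ S′ = ∀ {x} → T (S x) → T (S′ x)

sum-map-mono : (∀ x → f x ≤ g x) → ∀ xs → sum (map f xs) ≤ sum (map g xs)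
sum-map-mono f≤g []       = z≤n
sum-map-mono f≤g (x ∷ xs) = +-mono-≤ (f≤g x) (sum-map-mono f≤g xs)

sum-map-< : (∀ x → f x ≤ g x) → ∀ {x xs} → x ∈ xs → f x < g x → sum (map f xs) < sum (map g xs)
sum-map-< f≤g {xs = _ ∷ xs} (here refl)  fx<gx = +-mono-<-≤ fx<gx (sum-map-mono f≤g xs)
sum-map-< f≤g {xs = y ∷ _}  (there x∈xs) fx<gx = +-mono-≤-< (f≤g y) (sum-map-< f≤g x∈xs fx<gx)

sum-map-+ : ∀ (f g : A → ℕ) xs → sum (map (λ x → f x + g x) xs) ≡ sum (map f xs) + sum (map g xs)
sum-map-+ f g []       = refl
sum-map-+ f g (x ∷ xs) =
  trans (cong (_+_ (f x + g x)) (sum-map-+ f g xs))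
        (interchange +-commutativeSemigroup (f x) (g x) (sum (map f xs)) (sum (map g xs)))

sum-map-≡0 : (∀ x → f x ≡ 0) → ∀ xs → sum (map f xs) ≡ 0
sum-map-≡0 f≡0 []       = refl
sum-map-≡0 f≡0 (x ∷ xs) = cong₂ _+_ (f≡0 x) (sum-map-≡0 f≡0 xs)

sum-map-1 : ∀ (xs : List A) → sum (map (λ _ → 1) xs) ≡ length xs
sum-map-1 []       = refl
sum-map-1 (x ∷ xs) = cong suc (sum-map-1 xs)

sum-allFin-suc : ∀ {n} (f : Fin (suc n) → ℕ) →
                 sum (map f (allFin (suc n))) ≡ f zero + sum (map (f ∘ suc) (allFin n))
sum-allFin-suc f = cong (λ xs → f zero + sum xs) (trans (map-tabulate suc f) (sym (map-tabulate id (f ∘ suc))))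

sum-allFin-≤-at : ∀ {n} (f : Fin n → ℕ) w → (∀ x → x ≢ w → f x ≡ 0) → sum (map f (allFin n)) ≤ f w
sum-allFin-≤-at {suc n} f zero vanish = begin
  sum (map f (allFin (suc n)))              ≡⟨ sum-allFin-suc f ⟩
  f zero + sum (map (f ∘ suc) (allFin n))   ≡⟨ cong (_+_ (f zero)) (sum-map-≡0 (λ x → vanish (suc x) λ ()) (allFin n)) ⟩
  f zero + 0                                ≡⟨ +-identityʳ (f zero) ⟩
  f zero                                    ∎
  where open ≤-Reasoning
sum-allFin-≤-at {suc n} f (suc w) vanish = begin
  sum (map f (allFin (suc n)))              ≡⟨ sum-allFin-suc f ⟩
  f zero + sum (map (f ∘ suc) (allFin n))   ≡⟨ cong (_+ sum (map (f ∘ suc) (allFin n))) (vanish zero λ ()) ⟩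
  sum (map (f ∘ suc) (allFin n))
    ≤⟨ sum-allFin-≤-at (f ∘ suc) w (λ x x≢w → vanish (suc x) (x≢w ∘ Fin.suc-injective)) ⟩
  f (suc w)                                 ∎
  where open ≤-Reasoning

-- The indicator used in the definition of count is local to it; count over
-- Fin 1 exposes it (up to + 0), which is enough to identify it with ours.
count≡sum-indicator : ∀ {n} (S : Fin n → Bool) → count S ≡ sum (map (indicator ∘ S) (allFin n))
count≡sum-indicator {n} S = cong sum (map-cong (λ x → +-cancelʳ-≡ 0 _ _ (count-Fin1 (S x))) (allFin n))
  where
  count-Fin1 : ∀ b → count {1} (λ _ → b) ≡ indicator b + 0
  count-Fin1 true  = refl
  count-Fin1 false = refl

indicator-mono : ∀ {a b} → (T a → T b) → indicator a ≤ indicator b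
indicator-mono {false}         _   = z≤n
indicator-mono {true} {true}   _   = ≤-refl
indicator-mono {true} {false} a⇒b = ⊥-elim (a⇒b _)

indicator-∨ : ∀ a b → indicator (a ∨ b) ≤ indicator a + indicator b
indicator-∨ true  _ = s≤s z≤n
indicator-∨ false _ = ≤-refl

indicator-∨-disjoint : ∀ {a b} → (T a → ¬ T b) → indicator (a ∨ b) ≡ indicator a + indicator b
indicator-∨-disjoint {true}  {true}  a⇒¬b = ⊥-elim (a⇒¬b _ _)
indicator-∨-disjoint {true}  {false} _    = refl
indicator-∨-disjoint {false}         _    = refl

indicator-false : ∀ {a} → ¬ T a → indicator a ≡ 0
indicator-false {false} _  = refl
indicator-false {true}  ¬a = ⊥-elim (¬a _)

indicator-+-not : ∀ a → indicator a + indicator (not a) ≡ 1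
indicator-+-not true  = refl
indicator-+-not false = refl

module _ {n : ℕ} where

  count-mono : (S S′ : Fin n → Bool) → S ⊆ S′ → count S ≤ count S′
  count-mono S S′ S⊆S′
    rewrite count≡sum-indicator S | count≡sum-indicator S′
    = sum-map-mono (λ _ → indicator-mono S⊆S′) (allFin n)

  count-⊂ : (S S′ : Fin n → Bool) → S ⊆ S′ → ∀ {w} → T (S′ w) → ¬ T (S w) → count S < count S′
  count-⊂ S S′ S⊆S′ {w} w∈S′ w∉S
    rewrite count≡sum-indicator S | count≡sum-indicator S′
    = sum-map-< (λ _ → indicator-mono S⊆S′) (∈-allFin w) (indicator-< w∈S′ w∉S)
    where
    indicator-< : ∀ {a b} → T b → ¬ T a → indicator a < indicator b
    indicator-< {false} {true} _ _  = s≤s z≤n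
    indicator-< {true}         _ ¬a = ⊥-elim (¬a _)

  count-∨ : (S S′ : Fin n → Bool) → count (λ x → S x ∨ S′ x) ≤ count S + count S′
  count-∨ S S′
    rewrite count≡sum-indicator (λ x → S x ∨ S′ x) | count≡sum-indicator S | count≡sum-indicator S′
    = ≤-trans (sum-map-mono (λ x → indicator-∨ (S x) (S′ x)) (allFin n))
              (≤-reflexive (sum-map-+ (indicator ∘ S) (indicator ∘ S′) (allFin n)))

  count-∨-disjoint : (S S′ : Fin n → Bool) → (∀ {x} → T (S x) → ¬ T (S′ x)) →
                     count (λ x → S x ∨ S′ x) ≡ count S + count S′
  count-∨-disjoint S S′ disjoint
    rewrite count≡sum-indicator (λ x → S x ∨ S′ x) | count≡sum-indicator S | count≡sum-indicator S′
    = trans (cong sum (map-cong (λ _ → indicator-∨-disjoint disjoint) (allFin n)))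
            (sum-map-+ (indicator ∘ S) (indicator ∘ S′) (allFin n))

  count-+-count-not : (S : Fin n → Bool) → count S + count (not ∘ S) ≡ n
  count-+-count-not S
    rewrite count≡sum-indicator S | count≡sum-indicator (not ∘ S)
    = begin
      sum (map (indicator ∘ S) (allFin n)) + sum (map (indicator ∘ not ∘ S) (allFin n))
        ≡⟨ sum-map-+ (indicator ∘ S) (indicator ∘ not ∘ S) (allFin n) ⟨
      sum (map (λ x → indicator (S x) + indicator (not (S x))) (allFin n))
        ≡⟨ cong sum (map-cong (indicator-+-not ∘ S) (allFin n)) ⟩
      sum (map (λ _ → 1) (allFin n))
        ≡⟨ sum-map-1 (allFin n) ⟩
      length (allFin n)
        ≡⟨ length-tabulate id ⟩
      n ∎
    where open ≡-Reasoning

  count-empty : (S : Fin n → Bool) → (∀ x → ¬ T (S x)) → count S ≡ 0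
  count-empty S empty
    rewrite count≡sum-indicator S
    = sum-map-≡0 (λ x → indicator-false (empty x)) (allFin n)

  count-≤1 : {S : Fin n → Bool} {w : Fin n} → (∀ {x} → T (S x) → x ≡ w) → count S ≤ 1
  count-≤1 {S} {w} only-w
    rewrite count≡sum-indicator S
    = ≤-trans (sum-allFin-≤-at (indicator ∘ S) w (λ x x≢w → indicator-false (x≢w ∘ only-w)))
              (indicator-≤1 (S w))
    where
    indicator-≤1 : ∀ a → indicator a ≤ 1
    indicator-≤1 true  = ≤-refl
    indicator-≤1 false = z≤n

  count-pos : {S : Fin n → Bool} → 0 < count S → ∃ λ x → T (S x)
  count-pos {S} 0<count with Fin.any? (T? ∘ S)
  ... | yes found = found
  ... | no  none  = contradiction (count-empty S (λ x x∈S → none (x , x∈S))) (>⇒≢ 0<count)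

≤-foldr-⊔ : ∀ {x xs} → x ∈ xs → x ≤ foldr _⊔_ 0 xs
≤-foldr-⊔ (here refl)  = m≤m⊔n _ _
≤-foldr-⊔ (there x∈xs) = ≤-trans (≤-foldr-⊔ x∈xs) (m≤n⊔m _ _)

crossing⁻ : ∀ {p q a e} → T (p ∧ not q ∧ a ∧ e) → T p × ¬ T q × T a × T e
crossing⁻ {true}  {false} {true}  {true}  _ = _ , (λ ()) , _ , _
crossing⁻ {true}  {true}                  ()
crossing⁻ {true}  {false} {false}         ()
crossing⁻ {true}  {false} {true}  {false} ()
crossing⁻ {false}                         ()

crossing-∨ : ∀ b p b′ p′ e → T ((b ∨ p) ∧ not (b′ ∨ p′) ∧ e) →
             T ((b ∧ not b′ ∧ e) ∨ (p ∧ not p′ ∧ not b′ ∧ e))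
crossing-∨ true  _     false false true  _ = _
crossing-∨ true  _     true  _     _     ()
crossing-∨ true  _     false true  _     ()
crossing-∨ true  _     false false false ()
crossing-∨ false true  false false true  _ = _
crossing-∨ false true  true  _     _     ()
crossing-∨ false true  false true  _     ()
crossing-∨ false true  false false false ()
crossing-∨ false false _     _     _     ()

halves-+-< : ∀ {a b g} → 2 * a < g → 2 * b < g → a + b < g
halves-+-< {a} {b} {g} 2a<g 2b<g = *-cancelˡ-< 2 (a + b) g (begin-strict
  2 * (a + b)   ≡⟨ *-distribˡ-+ 2 a b ⟩
  2 * a + 2 * b <⟨ +-mono-< 2a<g 2b<g ⟩
  g + g         ≡⟨ cong (_+_ g) (+-identityʳ g) ⟨
  2 * g         ∎)
  where open ≤-Reasoning

shrunk-gap-bound : ∀ j {g p m} → p ≤ g → g ≤ 2 * p → suc j * g ≤ m → suc (suc j) * (g ∸ p) ≤ m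
shrunk-gap-bound j {g} {p} {m} p≤g g≤2p [j+1]g≤m = begin
  suc (suc j) * (g ∸ p)   ≤⟨ *-monoˡ-≤ (g ∸ p) (s≤s (s≤s (m≤m*n j 2))) ⟩
  suc j * 2 * (g ∸ p)     ≡⟨ *-assoc (suc j) 2 (g ∸ p) ⟩
  suc j * (2 * (g ∸ p))   ≤⟨ *-monoʳ-≤ (suc j) 2[g∸p]≤g ⟩
  suc j * g               ≤⟨ [j+1]g≤m ⟩
  m                       ∎
  where
  open ≤-Reasoning
  2[g∸p]≤g : 2 * (g ∸ p) ≤ g
  2[g∸p]≤g = begin
    2 * (g ∸ p)       ≡⟨ cong (_+_ (g ∸ p)) (+-identityʳ (g ∸ p)) ⟩
    (g ∸ p) + (g ∸ p) ≤⟨ +-monoʳ-≤ (g ∸ p) (m≤n+o⇒m∸n≤o g p (subst (g ≤_) (cong (_+_ p) (+-identityʳ p)) g≤2p)) ⟩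
    (g ∸ p) + p       ≡⟨ m∸n+n≡m p≤g ⟩
    g                 ∎

Unique-prefix : ∀ (xs : List A) {y ys} → Unique (xs ++ y ∷ ys) → Unique (xs ++ y ∷ [])
Unique-prefix []       _             = [] ∷ []
Unique-prefix (x ∷ xs) (x∉ ∷ unique) =
  All.++⁺ (All.++⁻ˡ xs x∉) (All.head (All.++⁻ʳ xs x∉) ∷ []) ∷ Unique-prefix xs unique

Linked-prefix-snoc : ∀ {R : A → A → Set} xs {y ys z} →
                     Linked R (xs ++ y ∷ ys) → R y z → Linked R ((xs ++ y ∷ []) ++ z ∷ [])
Linked-prefix-snoc []            _          yRz = yRz ∷ [-]
Linked-prefix-snoc (x ∷ [])      (xRy ∷ _)  yRz = xRy ∷ yRz ∷ [-]
Linked-prefix-snoc (x ∷ x′ ∷ xs) (xRx′ ∷ l) yRz = xRx′ ∷ Linked-prefix-snoc (x′ ∷ xs) l yRz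

retarget : ∀ {n} → Fin n → Fin n → Fin n → Fin n
retarget ℓ u w with w Fin.≟ ℓ
... | yes _ = u
... | no  _ = w

retarget-from : ∀ {n} {ℓ u : Fin n} → retarget ℓ u ℓ ≡ u
retarget-from {ℓ = ℓ} with ℓ Fin.≟ ℓ
... | yes _   = refl
... | no ℓ≢ℓ = contradiction refl ℓ≢ℓ

retarget-other : ∀ {n} {ℓ u w : Fin n} → w ≢ ℓ → retarget ℓ u w ≡ w
retarget-other {ℓ = ℓ} {w = w} w≢ℓ with w Fin.≟ ℓ
... | yes w≡ℓ = contradiction w≡ℓ w≢ℓ
... | no  _   = refl

-- Cuts, pieces and bags

module _ {n : ℕ} (G : Graph n) where

  private
    V = Fin n

  open import Data.List.Membership.DecPropositional (Fin._≟_ {n}) using (_∈?_)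

  Adj-sym : ∀ {x y} → Adj G x y → Adj G y x
  Adj-sym {x} {y} x~y = trans (adj-sym G y x) x~y

  Adj-irrefl : ∀ {x} → ¬ Adj G x x
  Adj-irrefl {x} x~x = contradiction (trans (sym x~x) (irrefl G x)) λ ()

  eBW-within : (W P : V → Bool) → ℕ
  eBW-within W P = sum (map (λ x → count (λ y → P x ∧ not (P y) ∧ W y ∧ adj G x y)) (allFin n))

  degree≤Δ : ∀ w → degree G w ≤ Δ G
  degree≤Δ w = ≤-foldr-⊔ (∈-map⁺ (degree G) (∈-allFin w))

  eBW-within-≤-degree : ∀ {W P : V → Bool} {w} →
    (∀ {x y} → T (P x) → ¬ T (P y) → T (W y) → Adj G x y → x ≡ w) → eBW-within W P ≤ degree G w
  eBW-within-≤-degree {W} {P} {w} exits-at-w =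
    ≤-trans (sum-allFin-≤-at _ w (λ x x≢w → count-empty _ (λ y → x≢w ∘ exit x y)))
            (count-mono _ (adj G w) (λ {y} e → let _ , _ , _ , w~y = crossing⁻ {P w} {P y} {W y} e in w~y))
    where
    exit : ∀ x y → T (P x ∧ not (P y) ∧ W y ∧ adj G x y) → x ≡ w
    exit x y e with crossing⁻ {P x} {P y} {W y} e
    ... | x∈P , y∉P , y∈W , x~y = exits-at-w x∈P y∉P y∈W (Equivalence.to T-≡ x~y)

  eBW-∨ : (B P : V → Bool) → eBW G (λ v → B v ∨ P v) ≤ eBW G B + eBW-within (not ∘ B) P
  eBW-∨ B P = ≤-trans (sum-map-mono row (allFin n)) (≤-reflexive (sum-map-+ out-of-B out-of-P (allFin n)))
    where
    out-of-B out-of-P : V → ℕ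
    out-of-B u = count (λ v → B u ∧ not (B v) ∧ adj G u v)
    out-of-P u = count (λ v → P u ∧ not (P v) ∧ not (B v) ∧ adj G u v)
    row : ∀ u → count (λ v → (B u ∨ P u) ∧ not (B v ∨ P v) ∧ adj G u v) ≤ out-of-B u + out-of-P u
    row u = ≤-trans (count-mono _ _ (λ {v} → crossing-∨ (B u) (P u) (B v) (P v) (adj G u v)))
                    (count-∨ (λ v → B u ∧ not (B v) ∧ adj G u v)
                             (λ v → P u ∧ not (P v) ∧ not (B v) ∧ adj G u v))

  record Piece (W : V → Bool) (g : ℕ) : Set where
    field
      P            : V → Bool
      P⊆W          : P ⊆ W
      g≤2∣P∣       : g ≤ 2 * count P
      ∣P∣≤g        : count P ≤ g
      hub          : V
      exits-at-hub : ∀ {x y} → T (P x) → ¬ T (P y) → T (W y) → Adj G x y → x ≡ hub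

  record Leaf (X : V → Bool) : Set where
    field
      leaf parent : V
      leaf∈X      : T (X leaf)
      parent∈X    : T (X parent)
      leaf≢parent : leaf ≢ parent
      hangs       : ∀ {y} → T (X y) → Adj G leaf y → y ≡ parent

  module _ (W : V → Bool) where

    record Bags : Set where
      field
        owners       : V → Bool
        owner        : V → V
        owner∈owners : ∀ {y} → T (W y) → T (owners (owner y))
        cross-edge   : ∀ {y z} → T (W y) → T (W z) → Adj G y z → owner y ≢ owner z → owner y ≡ y

      bag : V → V → Bool
      bag x y = W y ∧ isYes (owner y Fin.≟ x)

      bag⁺ : ∀ {x y} → T (W y) → owner y ≡ x → T (bag x y)
      bag⁺ {x} {y} y∈W owner≡x = Equivalence.from T-∧ (y∈W , fromWitness {a? = owner y Fin.≟ x} owner≡x)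

      bag⁻ : ∀ {x y} → T (bag x y) → T (W y) × owner y ≡ x
      bag⁻ {x} {y} y∈bag = let y∈W , owner≡x = Equivalence.to T-∧ y∈bag
                           in y∈W , toWitness {a? = owner y Fin.≟ x} owner≡x

      bag-exits : ∀ {x y z} → T (bag x y) → ¬ T (bag x z) → T (W z) → Adj G y z → y ≡ x
      bag-exits y∈bag z∉bag z∈W y~z =
        let y∈W , owner-y≡x = bag⁻ y∈bag
            owners-differ   = λ same → z∉bag (bag⁺ z∈W (trans (sym same) owner-y≡x))
        in trans (sym (cross-edge y∈W z∈W y~z owners-differ)) owner-y≡x

    open Bags

    singletons : Bags
    singletons = record { owners = W ; owner = id ; owner∈owners = id ; cross-edge = λ _ _ _ _ → refl }

    singleton-bag-≤1 : ∀ x → count (bag singletons x) ≤ 1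
    singleton-bag-≤1 x = count-≤1 (proj₂ ∘ bag⁻ singletons)

    module _ (B : Bags) (L : Leaf (owners B)) where
      open Leaf L renaming (leaf to ℓ; parent to u)

      merge : Bags
      merge = record
        { owners       = λ y → owners B y ∧ isNo (y Fin.≟ ℓ)
        ; owner        = retarget ℓ u ∘ owner B
        ; owner∈owners = owner∈owners′
        ; cross-edge   = cross-edge′
        }
        where
        owners′⁺ : ∀ {y} → T (owners B y) → y ≢ ℓ → T (owners B y ∧ isNo (y Fin.≟ ℓ))
        owners′⁺ y∈owners y≢ℓ = Equivalence.from T-∧ (y∈owners , fromWitnessFalse y≢ℓ)

        owner∈owners′ : ∀ {y} → T (W y) →
                        T (owners B (retarget ℓ u (owner B y)) ∧ isNo (retarget ℓ u (owner B y) Fin.≟ ℓ))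
        owner∈owners′ {y} y∈W with toSum (owner B y Fin.≟ ℓ)
        ... | inj₁ owner≡ℓ rewrite owner≡ℓ | retarget-from {ℓ = ℓ} {u} =
          owners′⁺ parent∈X (≢-sym leaf≢parent)
        ... | inj₂ owner≢ℓ rewrite retarget-other {u = u} owner≢ℓ =
          owners′⁺ (owner∈owners B y∈W) owner≢ℓ

        cross-edge′ : ∀ {y z} → T (W y) → T (W z) → Adj G y z →
                      retarget ℓ u (owner B y) ≢ retarget ℓ u (owner B z) → retarget ℓ u (owner B y) ≡ y
        cross-edge′ {y} {z} y∈W z∈W y~z differ = trans (retarget-other owner-y≢ℓ) owner-y≡y
          where
          owners-differ : owner B y ≢ owner B z
          owners-differ = differ ∘ cong (retarget ℓ u)
          owner-y≡y = cross-edge B y∈W z∈W y~z owners-differ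
          owner-z≡z = cross-edge B z∈W y∈W (Adj-sym y~z) (≢-sym owners-differ)
          -- If y were the leaf ℓ, then z, an owner adjacent to ℓ, would be
          -- its parent u, and both bags would be retargeted to u.
          owner-y≢ℓ : owner B y ≢ ℓ
          owner-y≢ℓ owner-y≡ℓ = differ (begin
            retarget ℓ u (owner B y) ≡⟨ cong (retarget ℓ u) owner-y≡ℓ ⟩
            retarget ℓ u ℓ           ≡⟨ retarget-from {ℓ = ℓ} ⟩
            u                        ≡⟨ retarget-other (≢-sym leaf≢parent) ⟨
            retarget ℓ u u           ≡⟨ cong (retarget ℓ u) (trans (sym z≡u) (sym owner-z≡z)) ⟩
            retarget ℓ u (owner B z) ∎)
            where
            open ≡-Reasoning
            y≡ℓ : y ≡ ℓ
            y≡ℓ = trans (sym owner-y≡y) owner-y≡ℓ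
            z≡u : z ≡ u
            z≡u = hangs (subst (T ∘ owners B) owner-z≡z (owner∈owners B z∈W)) (subst (λ v → Adj G v z) y≡ℓ y~z)

      bag-merge-parent : bag merge u ⊆ (λ y → bag B u y ∨ bag B ℓ y)
      bag-merge-parent {y} y∈bag with bag⁻ merge y∈bag | toSum (owner B y Fin.≟ ℓ)
      ... | y∈W , _   | inj₁ owner≡ℓ = Equivalence.from T-∨ (inj₂ (bag⁺ B y∈W owner≡ℓ))
      ... | y∈W , r≡u | inj₂ owner≢ℓ =
        Equivalence.from T-∨ (inj₁ (bag⁺ B y∈W (trans (sym (retarget-other owner≢ℓ)) r≡u)))

      bag-merge-other : ∀ {x} → x ≢ u → bag merge x ⊆ bag B x
      bag-merge-other x≢u {y} y∈bag with bag⁻ merge y∈bag | toSum (owner B y Fin.≟ ℓ)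
      ... | _   , r≡x | inj₁ owner≡ℓ =
        contradiction (trans (sym (trans (cong (retarget ℓ u) owner≡ℓ) (retarget-from {ℓ = ℓ}))) r≡x) (≢-sym x≢u)
      ... | y∈W , r≡x | inj₂ owner≢ℓ = bag⁺ B y∈W (trans (sym (retarget-other owner≢ℓ)) r≡x)

      owners-shrink : count (owners merge) < count (owners B)
      owners-shrink = count-⊂ (owners merge) (owners B) (λ {y} h → proj₁ (Equivalence.to (T-∧ {owners B y}) h))
                              leaf∈X (λ h → toWitnessFalse (proj₂ (Equivalence.to (T-∧ {owners B ℓ}) h)) refl)

    module _ {g : ℕ} where

      Bounded Small : Bags → Set
      Bounded B = ∀ {x} → T (owners B x) → count (bag B x) ≤ g
      Small   B = ∀ {x} → T (owners B x) → 2 * count (bag B x) < g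

      bounded-merge : (B : Bags) (L : Leaf (owners B)) → Bounded B → Small B → Bounded (merge B L)
      bounded-merge B L bounded small {x} x∈owners′ with x Fin.≟ Leaf.parent L
      ... | yes refl = begin
        count (bag (merge B L) x)             ≤⟨ count-mono _ (λ y → bag B x y ∨ bag B ℓ y) (bag-merge-parent B L) ⟩
        count (λ y → bag B x y ∨ bag B ℓ y)   ≤⟨ count-∨ (bag B x) (bag B ℓ) ⟩
        count (bag B x) + count (bag B ℓ)     <⟨ halves-+-< {count (bag B x)} (small parent∈X) (small leaf∈X) ⟩
        g                                     ∎
        where
        open ≤-Reasoning
        open Leaf L renaming (leaf to ℓ)
      ... | no x≢u = ≤-trans (count-mono (bag (merge B L) x) (bag B x) (bag-merge-other B L x≢u))
                             (bounded (proj₁ (Equivalence.to (T-∧ {owners B x}) x∈owners′)))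

  -- Leaves of forests and the piece lemma

  module _ (forest : Forest G) where

    no-chord : ∀ {e p r y} → Unique (e ∷ p ∷ r) → Linked (Adj G) (e ∷ p ∷ r) → y ∈ r → ¬ Adj G e y
    no-chord {e} {p} {r} {y} unique path y∈r e~y with ∈-∃++ y∈r
    ... | r₁ , r₂ , refl = forest record
      { start  = e
      ; rest   = p ∷ r₁ ++ y ∷ []
      ; long   = s≤s (subst (1 ≤_) (sym (length-++ r₁)) (m≤n+m 1 (length r₁)))
      ; unique = Unique-prefix (e ∷ p ∷ r₁) unique
      ; closed = Linked-prefix-snoc (e ∷ p ∷ r₁) path (Adj-sym e~y)
      }

    unvisited : List V → V → Bool
    unvisited ps y = isNo (y ∈? ps)

    module _ (X : V → Bool) where

      -- The path e ∷ p ∷ r is listed from its current end e backwards; once it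
      -- cannot be extended inside X, acyclicity leaves p as the only X-neighbour of e.
      walk : ∀ e p r → All (T ∘ X) (e ∷ p ∷ r) → Unique (e ∷ p ∷ r) → Linked (Adj G) (e ∷ p ∷ r) →
             Acc _<_ (count (unvisited (e ∷ p ∷ r))) → Leaf X
      walk e p r in-X unique path (acc smaller)
        with Fin.any? (λ y → T? (X y) ×-dec ¬? (y ∈? (e ∷ p ∷ r)) ×-dec (adj G e y Bool.≟ true))
      ... | yes (y , y∈X , y∉path , e~y) =
        walk y e (p ∷ r) (y∈X ∷ in-X) (¬Any⇒All¬ _ y∉path ∷ unique) (Adj-sym e~y ∷ path) (smaller fewer-unvisited)
        where
        fewer-unvisited : count (unvisited (y ∷ e ∷ p ∷ r)) < count (unvisited (e ∷ p ∷ r))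
        fewer-unvisited = count-⊂ (unvisited (y ∷ e ∷ p ∷ r)) (unvisited (e ∷ p ∷ r))
                                  (λ h → fromWitnessFalse (toWitnessFalse h ∘ there))
                                  {y} (fromWitnessFalse y∉path) (λ h → toWitnessFalse h (here refl))
      ... | no none = record
        { leaf = e ; parent = p
        ; leaf∈X = All.head in-X ; parent∈X = All.head (All.tail in-X)
        ; leaf≢parent = All.head (AllPairs.head unique)
        ; hangs = hangs
        }
        where
        hangs : ∀ {y} → T (X y) → Adj G e y → y ≡ p
        hangs {y} y∈X e~y with y ∈? (e ∷ p ∷ r)
        ... | no y∉path               = ⊥-elim (none (y , y∈X , y∉path , e~y))
        ... | yes (here refl)         = ⊥-elim (Adj-irrefl e~y)
        ... | yes (there (here y≡p))  = y≡p
        ... | yes (there (there y∈r)) = ⊥-elim (no-chord unique path y∈r e~y)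

      leaf-exists : ∀ {s x} → T (X s) → T (X x) → s ≢ x → Leaf X
      leaf-exists {s} {x} s∈X x∈X s≢x with Fin.any? (λ y → T? (X y) ×-dec (adj G s y Bool.≟ true))
      ... | yes (y , y∈X , s~y) =
        walk y s [] (y∈X ∷ s∈X ∷ []) ((y≢s ∷ []) ∷ [] ∷ []) (Adj-sym s~y ∷ [-]) (<-wellFounded _)
        where
        y≢s : y ≢ s
        y≢s refl = Adj-irrefl s~y
      ... | no none = record
        { leaf = s ; parent = x ; leaf∈X = s∈X ; parent∈X = x∈X ; leaf≢parent = s≢x
        ; hangs = λ y∈X s~y → ⊥-elim (none (_ , y∈X , s~y))
        }

    module _ (W : V → Bool) where

      open Bags

      leaf-or-one-bag : (B : Bags W) → ∀ {a} → T (W a) → Leaf (owners B) ⊎ W ⊆ bag B (owner B a)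
      leaf-or-one-bag B {a} a∈W with Fin.any? (λ y → T? (owners B y) ×-dec ¬? (y Fin.≟ owner B a))
      ... | yes (y , y∈owners , y≢owner) = inj₁ (leaf-exists (owners B) y∈owners (owner∈owners B a∈W) y≢owner)
      ... | no  alone = inj₂ λ {y} y∈W → bag⁺ B y∈W
        (decidable-stable (owner B y Fin.≟ owner B a) (λ ne → alone (owner B y , owner∈owners B y∈W , ne)))

      module _ {g : ℕ} (1≤g : 1 ≤ g) (g≤∣W∣ : g ≤ count W) where

        grow : (B : Bags W) → Bounded W B → Acc _<_ (count (owners B)) → Piece W g
        grow B bounded (acc smaller) with Fin.any? (λ x → T? (owners B x) ×-dec (g ≤? 2 * count (bag B x)))
        ... | yes (x , x∈owners , big) = record
          { P = bag B x ; P⊆W = proj₁ ∘ bag⁻ B ; g≤2∣P∣ = big ; ∣P∣≤g = bounded x∈owners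
          ; hub = x ; exits-at-hub = bag-exits B
          }
        ... | no no-big = merge-step
          where
          small : Small W B
          small x∈owners = ≰⇒> (λ big → no-big (_ , x∈owners , big))
          merge-step : Piece W g
          merge-step with count-pos (≤-trans 1≤g g≤∣W∣)
          ... | a , a∈W with leaf-or-one-bag B a∈W
          ...   | inj₁ L     = grow (merge W B L) (bounded-merge W B L bounded small) (smaller (owners-shrink W B L))
          ...   | inj₂ W⊆bag = contradiction (small (owner∈owners B a∈W)) (≤⇒≯ (begin
            g                               ≤⟨ g≤∣W∣ ⟩
            count W                         ≤⟨ count-mono W (bag B (owner B a)) W⊆bag ⟩
            count (bag B (owner B a))       ≤⟨ m≤n*m (count (bag B (owner B a))) 2 ⟩
            2 * count (bag B (owner B a))   ∎))
            where open ≤-Reasoning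

        piece : Piece W g
        piece = grow (singletons W) (λ {x} _ → ≤-trans (singleton-bag-≤1 W x) 1≤g) (<-wellFounded _)

    record Approx (m j : ℕ) : Set where
      field
        B         : V → Bool
        gap       : ℕ
        ∣B∣+gap   : count B + gap ≡ m
        gap-bound : suc j * gap ≤ m
        eBW≤      : eBW G B ≤ j * Δ G

    approx-start : ∀ {m} → Approx m 0
    approx-start {m} = record
      { B = λ _ → false ; gap = m
      ; ∣B∣+gap = cong (_+ m) (count-empty (λ (_ : V) → false) λ _ ())
      ; gap-bound = ≤-reflexive (+-identityʳ m)
      ; eBW≤ = ≤-reflexive (sum-map-≡0 (λ _ → count-empty (λ (_ : V) → false) λ _ ()) (allFin n))
      }

    approx-step : ∀ {m j} → m ≤ n → Approx m j → Approx m (suc j)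
    approx-step {m} {j} m≤n approx with Approx.gap approx in gap≡
    ... | zero = record
      { B = B ; gap = 0
      ; ∣B∣+gap = trans (cong (_+_ (count B)) (sym gap≡)) ∣B∣+gap
      ; gap-bound = subst (_≤ m) (sym (*-zeroʳ (suc (suc j)))) z≤n
      ; eBW≤ = ≤-trans eBW≤ (m≤n+m (j * Δ G) (Δ G))
      }
      where open Approx approx
    ... | suc _ = record
      { B = λ v → B v ∨ P v ; gap = gap ∸ count P
      ; ∣B∣+gap = begin-equality
          count (λ v → B v ∨ P v) + (gap ∸ count P)
            ≡⟨ cong (_+ (gap ∸ count P)) (count-∨-disjoint B P λ b p → T-not⇒¬T (P⊆W p) b) ⟩
          count B + count P + (gap ∸ count P)     ≡⟨ +-assoc (count B) (count P) (gap ∸ count P) ⟩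
          count B + (count P + (gap ∸ count P))   ≡⟨ cong (_+_ (count B)) (m+[n∸m]≡n ∣P∣≤g) ⟩
          count B + gap                           ≡⟨ ∣B∣+gap ⟩
          m                                       ∎
      ; gap-bound = shrunk-gap-bound j ∣P∣≤g g≤2∣P∣ gap-bound
      ; eBW≤ = begin
          eBW G (λ v → B v ∨ P v)            ≤⟨ eBW-∨ B P ⟩
          eBW G B + eBW-within (not ∘ B) P   ≤⟨ +-mono-≤ eBW≤ (eBW-within-≤-degree exits-at-hub) ⟩
          j * Δ G + degree G hub             ≤⟨ +-monoʳ-≤ (j * Δ G) (degree≤Δ hub) ⟩
          j * Δ G + Δ G                      ≡⟨ +-comm (j * Δ G) (Δ G) ⟩
          suc j * Δ G                        ∎
      }
      where
      open Approx approx
      open ≤-Reasoning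
      gap≤∣W∣ : gap ≤ count (not ∘ B)
      gap≤∣W∣ = +-cancelˡ-≤ (count B) gap (count (not ∘ B))
                  (subst (count B + gap ≤_) (sym (count-+-count-not B)) (subst (_≤ n) (sym ∣B∣+gap) m≤n))
      open Piece (piece (not ∘ B) (subst (1 ≤_) (sym gap≡) (s≤s z≤n)) gap≤∣W∣)

    approx : ∀ {m} → m ≤ n → ∀ j → Approx m j
    approx m≤n zero    = approx-start
    approx m≤n (suc j) = approx-step m≤n (approx m≤n j)

-- The rational bound

fromℤ : ℤ → ℚ
fromℤ z = z ℚ./ 1

toℚᵘ-fromℤ : ∀ z → ℚ.toℚᵘ (fromℤ z) ℚᵘ.≃ mkℚᵘ z 0
toℚᵘ-fromℤ z = ℚ.toℚᵘ-fromℚᵘ (mkℚᵘ z 0)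

fromℤ-mono-< : ∀ {a b} → a ℤ.< b → fromℤ a ℚ.< fromℤ b
fromℤ-mono-< {a} {b} a<b = ℚ.toℚᵘ-cancel-<
  (ℚᵘ.<-respˡ-≃ (ℚᵘ.≃-sym (toℚᵘ-fromℤ a)) (ℚᵘ.<-respʳ-≃ (ℚᵘ.≃-sym (toℚᵘ-fromℤ b))
    (*<* (subst₂ ℤ._<_ (sym (ℤ.*-identityʳ a)) (sym (ℤ.*-identityʳ b)) a<b))))

fromℤ-cancel-< : ∀ {a b} → fromℤ a ℚ.< fromℤ b → a ℤ.< b
fromℤ-cancel-< {a} {b} a<b
  with ℚᵘ.<-respˡ-≃ (toℚᵘ-fromℤ a) (ℚᵘ.<-respʳ-≃ (toℚᵘ-fromℤ b) (ℚ.toℚᵘ-mono-< a<b))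
... | *<* a*1<b*1 = subst₂ ℤ._<_ (ℤ.*-identityʳ a) (ℤ.*-identityʳ b) a*1<b*1

fromℤ-homo-+ : ∀ a b → fromℤ (a ℤ.+ b) ≡ fromℤ a ℚ.+ fromℤ b
fromℤ-homo-+ a b = ℚ.toℚᵘ-injective (begin
  ℚ.toℚᵘ (fromℤ (a ℤ.+ b))                 ≈⟨ toℚᵘ-fromℤ (a ℤ.+ b) ⟩
  mkℚᵘ (a ℤ.+ b) 0
    ≈⟨ *≡* (cong (ℤ._* + 1) (sym (cong₂ ℤ._+_ (ℤ.*-identityʳ a) (ℤ.*-identityʳ b)))) ⟩
  mkℚᵘ a 0 ℚᵘ.+ mkℚᵘ b 0                    ≈⟨ ℚᵘ.+-cong (toℚᵘ-fromℤ a) (toℚᵘ-fromℤ b) ⟨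
  ℚ.toℚᵘ (fromℤ a) ℚᵘ.+ ℚ.toℚᵘ (fromℤ b)    ≈⟨ ℚ.toℚᵘ-homo-+ (fromℤ a) (fromℤ b) ⟨
  ℚ.toℚᵘ (fromℤ a ℚ.+ fromℤ b)              ∎)
  where open ℚᵘ.≃-Reasoning

fromℤ-homo-* : ∀ a b → fromℤ (a ℤ.* b) ≡ fromℤ a ℚ.* fromℤ b
fromℤ-homo-* a b = ℚ.toℚᵘ-injective (begin
  ℚ.toℚᵘ (fromℤ (a ℤ.* b))                 ≈⟨ toℚᵘ-fromℤ (a ℤ.* b) ⟩
  mkℚᵘ (a ℤ.* b) 0                          ≈⟨ *≡* refl ⟩
  mkℚᵘ a 0 ℚᵘ.* mkℚᵘ b 0                    ≈⟨ ℚᵘ.*-cong (toℚᵘ-fromℤ a) (toℚᵘ-fromℤ b) ⟨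
  ℚ.toℚᵘ (fromℤ a) ℚᵘ.* ℚ.toℚᵘ (fromℤ b)    ≈⟨ ℚ.toℚᵘ-homo-* (fromℤ a) (fromℤ b) ⟨
  ℚ.toℚᵘ (fromℤ a ℚ.* fromℤ b)              ∎)
  where open ℚᵘ.≃-Reasoning

-- floor unfolds only on an explicit mkℚ, hence the pattern.
floor*↧≤↥ : ∀ q → ℚ.floor q ℤ.* ↧ q ℤ.≤ ↥ q
floor*↧≤↥ q@(mkℚ _ _ _) = [n/d]*d≤n (↥ q) (↧ q)

≤-fromℤ-ceiling : ∀ p → p ℚ.≤ fromℤ (ℚ.ceiling p)
≤-fromℤ-ceiling p@(mkℚ n d _) =
  ℚ.toℚᵘ-cancel-≤ (ℚᵘ.≤-respʳ-≃ (ℚᵘ.≃-sym (toℚᵘ-fromℤ (ℚ.ceiling p))) (*≤* n≤ceiling*d))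
  where
  z = ℚ.floor (ℚ.- p)
  n≤ceiling*d : n ℤ.* + 1 ℤ.≤ ℤ.- z ℤ.* + suc d
  n≤ceiling*d = begin
    n ℤ.* + 1                ≡⟨ ℤ.*-identityʳ n ⟩
    n                        ≡⟨ ℤ.neg-involutive n ⟨
    ℤ.- (ℤ.- n)              ≤⟨ ℤ.neg-mono-≤ z*d≤-n ⟩
    ℤ.- (z ℤ.* + suc d)      ≡⟨ ℤ.neg-distribˡ-* z (+ suc d) ⟩
    ℤ.- z ℤ.* + suc d        ∎
    where
    open ℤ.≤-Reasoning
    z*d≤-n : z ℤ.* + suc d ℤ.≤ ℤ.- n
    z*d≤-n = subst₂ (λ D N → z ℤ.* D ℤ.≤ N) (ℚ.↧-neg p) (ℚ.↥-neg p) (floor*↧≤↥ (ℚ.- p))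

toℚ-homo-* : ∀ a b → toℚ (a * b) ≡ toℚ a ℚ.* toℚ b
toℚ-homo-* a b = trans (cong fromℤ (ℤ.pos-* a b)) (fromℤ-homo-* (+ a) (+ b))

toℚ-pos : ∀ {a} → 0 < a → ℚ.Positive (toℚ a)
toℚ-pos 0<a = ℚ.positive (fromℤ-mono-< (ℤ.+<+ 0<a))

*-split-complement : ∀ a c → a ℚ.* c ℚ.+ a ℚ.* (1ℚ ℚ.- c) ≡ a
*-split-complement = solve 2 (λ a c → a :* c :+ a :* (con 1ℚ :- c) := a) refl
  where open ℚ.+-*-Solver

ceilRatio-bound : ∀ {c} → 0ℚ ℚ.< c → (c<1 : c ℚ.< 1ℚ) →
                  ∃ λ k → 1 ≤ k × ceilRatio c c<1 ≡ + k × toℚ (k + 2) ℚ.* c ℚ.≤ toℚ k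
ceilRatio-bound {c} 0<c c<1 = from-positive (ceilRatio c c<1) refl 0<ceilRatio 2c≤ceilRatio*d
  where
  d = 1ℚ ℚ.- c
  instance
    d-nonZero : ℚ.NonZero d
    d-nonZero = ℚ.>-nonZero (0<1-c c<1)
    d-nonNeg : ℚ.NonNegative d
    d-nonNeg = ℚ.nonNegative (ℚ.<⇒≤ (0<1-c c<1))
    2-pos : ℚ.Positive (toℚ 2)
    2-pos = toℚ-pos {2} (s≤s z≤n)
  q = toℚ 2 ℚ.* c ℚ.÷ d
  q*d≡2c : q ℚ.* d ≡ toℚ 2 ℚ.* c
  q*d≡2c = begin
    toℚ 2 ℚ.* c ℚ.* ℚ.1/ d ℚ.* d     ≡⟨ ℚ.*-assoc (toℚ 2 ℚ.* c) (ℚ.1/ d) d ⟩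
    toℚ 2 ℚ.* c ℚ.* (ℚ.1/ d ℚ.* d)   ≡⟨ cong (toℚ 2 ℚ.* c ℚ.*_) (ℚ.*-inverseˡ d) ⟩
    toℚ 2 ℚ.* c ℚ.* 1ℚ               ≡⟨ ℚ.*-identityʳ (toℚ 2 ℚ.* c) ⟩
    toℚ 2 ℚ.* c                      ∎
    where open ≡-Reasoning
  0<2c : 0ℚ ℚ.< toℚ 2 ℚ.* c
  0<2c = subst (ℚ._< toℚ 2 ℚ.* c) (ℚ.*-zeroʳ (toℚ 2)) (ℚ.*-monoʳ-<-pos (toℚ 2) 0<c)
  0<q : 0ℚ ℚ.< q
  0<q = ℚ.*-cancelʳ-<-nonNeg d (subst₂ ℚ._<_ (sym (ℚ.*-zeroˡ d)) (sym q*d≡2c) 0<2c)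
  0<ceilRatio : + 0 ℤ.< ceilRatio c c<1
  0<ceilRatio = fromℤ-cancel-< (ℚ.<-≤-trans 0<q (≤-fromℤ-ceiling q))
  2c≤ceilRatio*d : toℚ 2 ℚ.* c ℚ.≤ fromℤ (ceilRatio c c<1) ℚ.* d
  2c≤ceilRatio*d =
    subst (ℚ._≤ fromℤ (ceilRatio c c<1) ℚ.* d) q*d≡2c (ℚ.*-monoʳ-≤-nonNeg d (≤-fromℤ-ceiling q))
  from-positive : ∀ K → ceilRatio c c<1 ≡ K → + 0 ℤ.< K → toℚ 2 ℚ.* c ℚ.≤ fromℤ K ℚ.* d →
                  ∃ λ k → 1 ≤ k × ceilRatio c c<1 ≡ + k × toℚ (k + 2) ℚ.* c ℚ.≤ toℚ k
  from-positive +0       _ (ℤ.+<+ ()) _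
  from-positive +[1+ k ] ceilRatio≡K _ 2c≤K*d = suc k , s≤s z≤n , ceilRatio≡K , (begin
    toℚ (suc k + 2) ℚ.* c                          ≡⟨ cong (ℚ._* c) (fromℤ-homo-+ (+ suc k) (+ 2)) ⟩
    (toℚ (suc k) ℚ.+ toℚ 2) ℚ.* c                  ≡⟨ ℚ.*-distribʳ-+ c (toℚ (suc k)) (toℚ 2) ⟩
    toℚ (suc k) ℚ.* c ℚ.+ toℚ 2 ℚ.* c              ≤⟨ ℚ.+-monoʳ-≤ (toℚ (suc k) ℚ.* c) 2c≤K*d ⟩
    toℚ (suc k) ℚ.* c ℚ.+ toℚ (suc k) ℚ.* d        ≡⟨ *-split-complement (toℚ (suc k)) c ⟩
    toℚ (suc k)                                    ∎)
    where open ℚ.≤-Reasoning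

gap<m : ∀ {k m gap} → 1 ≤ k → 1 ≤ m → suc k * gap ≤ m → gap < m
gap<m {gap = zero}          _   1≤m _ = 1≤m
gap<m {k} {m} {gap = suc g} 1≤k _   [k+1]gap≤m = begin-strict
  suc g           <⟨ m<m+n (suc g) z<s ⟩
  2 * suc g       ≤⟨ *-monoˡ-≤ (suc g) (s≤s 1≤k) ⟩
  suc k * suc g   ≤⟨ [k+1]gap≤m ⟩
  m               ∎
  where open ≤-Reasoning

k*m<[k+2]*b : ∀ {k m b gap} → 1 ≤ k → 1 ≤ m → b + gap ≡ m → suc k * gap ≤ m → k * m < (k + 2) * b
k*m<[k+2]*b {k} {m} {b} {gap} 1≤k 1≤m b+gap≡m [k+1]gap≤m =
  +-cancelʳ-< ((k + 2) * gap) (k * m) ((k + 2) * b) (begin-strict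
    k * m + (k + 2) * gap          ≡⟨ cong (_+_ (k * m)) [k+2]gap≡[k+1]gap+gap ⟩
    k * m + (suc k * gap + gap)    ≤⟨ +-monoʳ-≤ (k * m) (+-monoˡ-≤ gap [k+1]gap≤m) ⟩
    k * m + (m + gap)              <⟨ +-monoʳ-< (k * m) (+-monoʳ-< m (gap<m 1≤k 1≤m [k+1]gap≤m)) ⟩
    k * m + (m + m)                ≡⟨ solve 2 (λ k m → k :* m :+ (m :+ m) := (k :+ con 2) :* m) refl k m ⟩
    (k + 2) * m                    ≡⟨ cong ((k + 2) *_) b+gap≡m ⟨
    (k + 2) * (b + gap)            ≡⟨ *-distribˡ-+ (k + 2) b gap ⟩
    (k + 2) * b + (k + 2) * gap    ∎)
  where
  open ≤-Reasoning
  open +-*-Solver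
  [k+2]gap≡[k+1]gap+gap : (k + 2) * gap ≡ suc k * gap + gap
  [k+2]gap≡[k+1]gap+gap = solve 2 (λ k gap → (k :+ con 2) :* gap := (con 1 :+ k) :* gap :+ gap) refl k gap

cm<b : ∀ {c k m b} → 1 ≤ m → toℚ (k + 2) ℚ.* c ℚ.≤ toℚ k → k * m < (k + 2) * b →
       c ℚ.* toℚ m ℚ.< toℚ b
cm<b {c} {k} {m} {b} 1≤m [k+2]c≤k km<[k+2]b = ℚ.*-cancelˡ-<-nonNeg (toℚ (k + 2)) (begin-strict
  toℚ (k + 2) ℚ.* (c ℚ.* toℚ m)     ≡⟨ ℚ.*-assoc (toℚ (k + 2)) c (toℚ m) ⟨
  toℚ (k + 2) ℚ.* c ℚ.* toℚ m       ≤⟨ ℚ.*-monoʳ-≤-nonNeg (toℚ m) [k+2]c≤k ⟩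
  toℚ k ℚ.* toℚ m                   ≡⟨ toℚ-homo-* k m ⟨
  toℚ (k * m)                       <⟨ fromℤ-mono-< (ℤ.+<+ km<[k+2]b) ⟩
  toℚ ((k + 2) * b)                 ≡⟨ toℚ-homo-* (k + 2) b ⟩
  toℚ (k + 2) ℚ.* toℚ b             ∎)
  where
  open ℚ.≤-Reasoning
  instance
    k+2-nonNeg : ℚ.NonNegative (toℚ (k + 2))
    k+2-nonNeg = ℚ.pos⇒nonNeg (toℚ (k + 2)) {{toℚ-pos (<-≤-trans z<s (m≤n+m 2 k))}}
    m-nonNeg : ℚ.NonNegative (toℚ m)
    m-nonNeg = ℚ.pos⇒nonNeg (toℚ m) {{toℚ-pos 1≤m}}

lemma2p3 : (n : ℕ) (G : Graph n) → Forest G →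
    (m : ℕ) → 1 ℕ.≤ m → m ℕ.≤ n →
    (c : ℚ) → (0<c : 0ℚ ℚ.< c) → (c<1 : c ℚ.< 1ℚ) →
    Σ (Fin n → Bool) λ B →
      (+ eBW G B ℤ.≤ ceilRatio c c<1 ℤ.* + Δ G)
      × (c ℚ.* toℚ m ℚ.< toℚ ∣ B ∣ˢ)
      × (∣ B ∣ˢ ℕ.≤ m)
lemma2p3 n G forest m 1≤m m≤n c 0<c c<1 with ceilRatio-bound 0<c c<1
... | k , 1≤k , ceilRatio≡k , [k+2]c≤k = B , eBW-bound , cm<∣B∣ , ∣B∣≤m
  where
  open Approx (approx G forest m≤n k)
  eBW-bound : + eBW G B ℤ.≤ ceilRatio c c<1 ℤ.* + Δ G
  eBW-bound rewrite ceilRatio≡k = subst (+ eBW G B ℤ.≤_) (ℤ.pos-* k (Δ G)) (ℤ.+≤+ eBW≤)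
  cm<∣B∣ : c ℚ.* toℚ m ℚ.< toℚ (count B)
  cm<∣B∣ = cm<b {k = k} 1≤m [k+2]c≤k (k*m<[k+2]*b 1≤k 1≤m ∣B∣+gap gap-bound)
  ∣B∣≤m : count B ≤ m
  ∣B∣≤m = subst (count B ≤_) ∣B∣+gap (m≤m+n (count B) gap)
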